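{- There exist 2-qBMGs on five vertices whose underlying undirected graph is not $P_5$-free. More precisely, up to isomorphism there are exactly six 2-qBMGs on the vertex set $\{v_1,v_2,v_3,v_4,v_5\}$ whose underlying undirected graph is the path graph $v_1v_2v_3v_4v_5$ (with edges exactly $\{v_i,v_{i+1}\}$, $1\le i\le 4$), namely those with edge sets $\{v_1v_2,v_3v_2,v_3v_4,v_4v_5\}$, $\{v_1v_2,v_3v_2,v_3v_4,v_5v_4\}$, $\{v_2v_1,v_3v_2,v_3v_4,v_4v_5\}$, $\{v_1v_2,v_2v_1,v_3v_2,v_3v_4,v_4v_5\}$, $\{v_1v_2,v_2v_1,v_3v_2,v_3v_4,v_5v_4\}$, $\{v_1v_2,v_2v_1,v_3v_2,v_3v_4,v_4v_5,v_5v_4\}$ (where $xy$ denotes the directed edge from $x$ to $y$).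
   Context: A two-color quasi best match graph (2-qBMG) is a bipartite directed graph $\overrightarrow{G}$ (vertex set split into two color classes, every edge joining vertices of different colors) without loops and parallel edges, satisfying: (N1) if $u$ and $v$ are two independent (non-adjacent) vertices then there exist no vertices $w,t$ such that $ut, vw, tw$ are edges; (N2) if $uv, vw, wt$ are edges then $ut$ is an edge; (N3) if $u$ and $v$ have a common out-neighbor then either every out-neighbor of $u$ is an out-neighbor of $v$ or every out-neighbor of $v$ is an out-neighbor of $u$. The underlying undirected graph of a digraph has the same vertex set and an undirected edge $\{u,v\}$ whenever $uv$ or $vu$ is a directed edge. A graph is $P_5$-free if it has no induced subgraph isomorphic to the path graph on five vertices. Two digraphs on the same vertex set $V$ are isomorphic if some permutation $\varphi$ of $V$ satisfies: $xy$ is an edge of the first iff $\varphi(x)\varphi(y)$ is an edge of the second. -}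

module Defs where

open import Data.Nat using (ℕ; suc)
open import Data.Fin using (Fin; toℕ; zero; suc)
open import Data.Fin.Properties using () renaming (_≟_ to _≟ᶠ_)
open import Data.Fin.Permutation using (Permutation′; _⟨$⟩ʳ_)
open import Data.Bool using (Bool; true; false; _∧_; _∨_)
open import Data.List using (List; []; _∷_)
open import Data.Product using (Σ; ∃; ∃-syntax; _×_; _,_)
open import Data.Sum using (_⊎_)
open import Data.Empty using (⊥)
open import Relation.Nullary using (¬_; does)
open import Relation.Binary.PropositionalEquality using (_≡_; _≢_)

Digraph : ℕ → Set
Digraph n = Fin n → Fin n → Bool

module _ {n : ℕ} (G : Digraph n) where

  Edge : Fin n → Fin n → Set
  Edge x y = G x y ≡ true

  Adjacent : Fin n → Fin n → Set
  Adjacent x y = Edge x y ⊎ Edge y x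

  Loopless : Set
  Loopless = ∀ x → ¬ Edge x x

  Bipartite : Set
  Bipartite = Σ (Fin n → Bool) λ c → ∀ x y → Edge x y → c x ≢ c y

  N1 : Set
  N1 = ∀ u v → u ≢ v → ¬ Adjacent u v →
       ¬ (∃[ w ] ∃[ t ] (Edge u t × Edge v w × Edge t w))

  N2 : Set
  N2 = ∀ u v w t → Edge u v → Edge v w → Edge w t → Edge u t

  OutSub : Fin n → Fin n → Set
  OutSub u v = ∀ x → Edge u x → Edge v x

  N3 : Set
  N3 = ∀ u v → (∃[ w ] (Edge u w × Edge v w)) → OutSub u v ⊎ OutSub v u

  Is2qBMG : Set
  Is2qBMG = Loopless × Bipartite × N1 × N2 × N3

-- the path graph 0 - 1 - 2 - ... - (n-1)  (vertex v_i is Fin index i-1)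
PathAdj : {n : ℕ} → Fin n → Fin n → Set
PathAdj x y = toℕ y ≡ suc (toℕ x) ⊎ toℕ x ≡ suc (toℕ y)

UnderlyingIsPath : {n : ℕ} → Digraph n → Set
UnderlyingIsPath G = ∀ x y → (Adjacent G x y → PathAdj x y) × (PathAdj x y → Adjacent G x y)

Isomorphic : {n : ℕ} → Digraph n → Digraph n → Set
Isomorphic {n} G H = Σ (Permutation′ n) λ φ → ∀ x y → G x y ≡ H (φ ⟨$⟩ʳ x) (φ ⟨$⟩ʳ y)

fromEdges : {n : ℕ} → List (Fin n × Fin n) → Digraph n
fromEdges [] x y = false
fromEdges ((a , b) ∷ es) x y = (does (a ≟ᶠ x) ∧ does (b ≟ᶠ y)) ∨ fromEdges es x y

v₁ v₂ v₃ v₄ v₅ : Fin 5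
v₁ = zero
v₂ = suc zero
v₃ = suc (suc zero)
v₄ = suc (suc (suc zero))
v₅ = suc (suc (suc (suc zero)))

sixGraphs : Fin 6 → Digraph 5
sixGraphs zero = fromEdges ((v₁ , v₂) ∷ (v₃ , v₂) ∷ (v₃ , v₄) ∷ (v₄ , v₅) ∷ [])
sixGraphs (suc zero) = fromEdges ((v₁ , v₂) ∷ (v₃ , v₂) ∷ (v₃ , v₄) ∷ (v₅ , v₄) ∷ [])
sixGraphs (suc (suc zero)) = fromEdges ((v₂ , v₁) ∷ (v₃ , v₂) ∷ (v₃ , v₄) ∷ (v₄ , v₅) ∷ [])
sixGraphs (suc (suc (suc zero))) =
  fromEdges ((v₁ , v₂) ∷ (v₂ , v₁) ∷ (v₃ , v₂) ∷ (v₃ , v₄) ∷ (v₄ , v₅) ∷ [])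
sixGraphs (suc (suc (suc (suc zero)))) =
  fromEdges ((v₁ , v₂) ∷ (v₂ , v₁) ∷ (v₃ , v₂) ∷ (v₃ , v₄) ∷ (v₅ , v₄) ∷ [])
sixGraphs (suc (suc (suc (suc (suc zero))))) =
  fromEdges ((v₁ , v₂) ∷ (v₂ , v₁) ∷ (v₃ , v₂) ∷ (v₃ , v₄) ∷ (v₄ , v₅) ∷ (v₅ , v₄) ∷ [])

-- A digraph whose underlying graph is the path v₁…v₅ is determined by how each of its four
-- edges is oriented (forward, backward or both), and it is automatically bipartite (colour by
-- parity). Checking N1–N3 on all 3⁴ orientations leaves exactly the listed six graphs up to
-- reversal of the path. They are pairwise non-isomorphic because the isomorphism invariants
-- (number of arcs, number of sources) take the six distinct values (4,2), (4,3), (4,1), (5,1),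
-- (5,2), (6,1).
module Submission where

open import Defs
open import Data.Nat using (ℕ; zero; suc; _≡ᵇ_) renaming (_≟_ to _≟ℕ_)
open import Data.Nat.Properties using (+-0-commutativeMonoid)
open import Algebra.Properties.CommutativeMonoid.Sum +-0-commutativeMonoid
  using (sum; ∑-permute; sum-cong-≗)
open import Data.Bool using (Bool; true; false; not; if_then_else_) renaming (_≟_ to _≟ᵇ_)
open import Data.Bool.Properties using (not-¬; ¬-not)
open import Data.Fin using (Fin; toℕ)
open import Data.Fin.Patterns using (0F; 1F; 2F; 3F; 4F)
open import Data.Fin.Properties using (all?; any?) renaming (_≟_ to _≟ᶠ_)
open import Data.Fin.Permutation as Permutation using (Permutation′; _⟨$⟩ʳ_)
open import Data.Product using (∃-syntax; _×_; _,_; proj₁; proj₂)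
open import Data.Sum as Sum using (_⊎_; inj₁; inj₂)
open import Function using (_∘_)
open import Relation.Nullary using (Dec; ¬?)
open import Relation.Nullary.Decidable
  using (_×-dec_; _⊎-dec_; _→-dec_; map′; toWitness; False; toWitnessFalse)
open import Relation.Binary.PropositionalEquality using (_≡_; _≢_; refl; sym; trans; cong)

module _ {n : ℕ} (G : Digraph n) where

  Edge? : ∀ x y → Dec (Edge G x y)
  Edge? x y = G x y ≟ᵇ true

  Adjacent? : ∀ x y → Dec (Adjacent G x y)
  Adjacent? x y = Edge? x y ⊎-dec Edge? y x

  Loopless? : Dec (Loopless G)
  Loopless? = all? λ x → ¬? (Edge? x x)

  N1? : Dec (N1 G)
  N1? = all? λ u → all? λ v → ¬? (u ≟ᶠ v) →-dec ¬? (Adjacent? u v) →-dec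
          ¬? (any? λ w → any? λ t → Edge? u t ×-dec Edge? v w ×-dec Edge? t w)

  N2? : Dec (N2 G)
  N2? = all? λ u → all? λ v → all? λ w → all? λ t →
          Edge? u v →-dec Edge? v w →-dec Edge? w t →-dec Edge? u t

  OutSub? : ∀ u v → Dec (OutSub G u v)
  OutSub? u v = all? λ x → Edge? u x →-dec Edge? v x

  N3? : Dec (N3 G)
  N3? = all? λ u → all? λ v →
          any? (λ w → Edge? u w ×-dec Edge? v w) →-dec (OutSub? u v ⊎-dec OutSub? v u)

PathAdj? : {n : ℕ} (x y : Fin n) → Dec (PathAdj x y)
PathAdj? x y = toℕ y ≟ℕ suc (toℕ x) ⊎-dec toℕ x ≟ℕ suc (toℕ y)

UnderlyingIsPath? : {n : ℕ} (G : Digraph n) → Dec (UnderlyingIsPath G)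
UnderlyingIsPath? G = all? λ x → all? λ y →
  (Adjacent? G x y →-dec PathAdj? x y) ×-dec (PathAdj? x y →-dec Adjacent? G x y)

IsomorphicVia : {n : ℕ} → Digraph n → Digraph n → Permutation′ n → Set
IsomorphicVia G H φ = ∀ x y → G x y ≡ H (φ ⟨$⟩ʳ x) (φ ⟨$⟩ʳ y)

IsomorphicVia? : {n : ℕ} (G H : Digraph n) (φ : Permutation′ n) → Dec (IsomorphicVia G H φ)
IsomorphicVia? G H φ = all? λ x → all? λ y → G x y ≟ᵇ H (φ ⟨$⟩ʳ x) (φ ⟨$⟩ʳ y)

parity : ℕ → Bool
parity zero    = false
parity (suc m) = not (parity m)

parity-suc : ∀ m → parity m ≢ parity (suc m)
parity-suc m = not-¬ refl

path-bipartite : {n : ℕ} {G : Digraph n} → UnderlyingIsPath G → Bipartite G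
path-bipartite U = parity ∘ toℕ , λ x y xy → neighbours-differ (proj₁ (U x y) (inj₁ xy))
  where
  neighbours-differ : ∀ {x y} → PathAdj x y → parity (toℕ x) ≢ parity (toℕ y)
  neighbours-differ {x} (inj₁ y≡1+x) eq = parity-suc (toℕ x) (trans eq (cong parity y≡1+x))
  neighbours-differ {y = y} (inj₂ x≡1+y) eq = parity-suc (toℕ y) (trans (sym eq) (cong parity x≡1+y))

_≗₂_ : {n : ℕ} → Digraph n → Digraph n → Set
G ≗₂ H = ∀ x y → G x y ≡ H x y

module _ {n : ℕ} {G H : Digraph n} (G≗H : G ≗₂ H) where

  private
    to : ∀ {x y} → Edge G x y → Edge H x y
    to {x} {y} = trans (sym (G≗H x y))

    from : ∀ {x y} → Edge H x y → Edge G x y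
    from {x} {y} = trans (G≗H x y)

  N1-resp-≗₂ : N1 G → N1 H
  N1-resp-≗₂ n1 u v u≢v ¬adj (w , t , ut , vw , tw) =
    n1 u v u≢v (¬adj ∘ Sum.map to to) (w , t , from ut , from vw , from tw)

  N2-resp-≗₂ : N2 G → N2 H
  N2-resp-≗₂ n2 u v w t uv vw wt = to (n2 u v w t (from uv) (from vw) (from wt))

  N3-resp-≗₂ : N3 G → N3 H
  N3-resp-≗₂ n3 u v (w , uw , vw) =
    Sum.map (λ u⊆v x ux → to (u⊆v x (from ux))) (λ v⊆u x vx → to (v⊆u x (from vx)))
            (n3 u v (w , from uw , from vw))

indicator : Bool → ℕ
indicator b = if b then 1 else 0

module _ {n : ℕ} (G : Digraph n) where

  inDegree : Fin n → ℕ
  inDegree x = sum λ y → indicator (G y x)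

  edgeCount : ℕ
  edgeCount = sum inDegree

  sourceCount : ℕ
  sourceCount = sum λ x → indicator (inDegree x ≡ᵇ 0)

∑-reindex : {n : ℕ} (φ : Permutation′ n) {f g : Fin n → ℕ} →
            (∀ x → f x ≡ g (φ ⟨$⟩ʳ x)) → sum f ≡ sum g
∑-reindex φ {g = g} f≗g∘φ = trans (sum-cong-≗ f≗g∘φ) (sym (∑-permute g φ))

module _ {n : ℕ} {G H : Digraph n} (G≅H : Isomorphic G H) where

  private
    φ = proj₁ G≅H

  inDegree-iso : ∀ x → inDegree G x ≡ inDegree H (φ ⟨$⟩ʳ x)
  inDegree-iso x = ∑-reindex φ λ y → cong indicator (proj₂ G≅H y x)

  edgeCount-iso : edgeCount G ≡ edgeCount H
  edgeCount-iso = ∑-reindex φ inDegree-iso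

  sourceCount-iso : sourceCount G ≡ sourceCount H
  sourceCount-iso = ∑-reindex φ λ x → cong (λ d → indicator (d ≡ᵇ 0)) (inDegree-iso x)

data Orientation : Set where
  forward backward both : Orientation

hasForwardArc hasBackwardArc : Orientation → Bool
hasForwardArc forward  = true
hasForwardArc backward = false
hasForwardArc both     = true
hasBackwardArc forward  = false
hasBackwardArc backward = true
hasBackwardArc both     = true

orientationOfArcs : ∀ {a b} → a ≡ true ⊎ b ≡ true →
                    ∃[ o ] (a ≡ hasForwardArc o × b ≡ hasBackwardArc o)
orientationOfArcs {true}  {true}  _ = both , refl , refl
orientationOfArcs {true}  {false} _ = forward , refl , refl
orientationOfArcs {false} {true}  _ = backward , refl , refl
orientationOfArcs {false} {false} (inj₁ ())
orientationOfArcs {false} {false} (inj₂ ())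

all-orientations? : {P : Orientation → Set} → (∀ o → Dec (P o)) → Dec (∀ o → P o)
all-orientations? P? = map′
  (λ { (p , q , r) → λ { forward → p ; backward → q ; both → r } })
  (λ ∀p → ∀p forward , ∀p backward , ∀p both)
  (P? forward ×-dec P? backward ×-dec P? both)

orientedPath : Orientation → Orientation → Orientation → Orientation → Digraph 5
orientedPath o₁ o₂ o₃ o₄ 0F 1F = hasForwardArc  o₁
orientedPath o₁ o₂ o₃ o₄ 1F 0F = hasBackwardArc o₁
orientedPath o₁ o₂ o₃ o₄ 1F 2F = hasForwardArc  o₂
orientedPath o₁ o₂ o₃ o₄ 2F 1F = hasBackwardArc o₂
orientedPath o₁ o₂ o₃ o₄ 2F 3F = hasForwardArc  o₃
orientedPath o₁ o₂ o₃ o₄ 3F 2F = hasBackwardArc o₃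
orientedPath o₁ o₂ o₃ o₄ 3F 4F = hasForwardArc  o₄
orientedPath o₁ o₂ o₃ o₄ 4F 3F = hasBackwardArc o₄
orientedPath o₁ o₂ o₃ o₄ _  _  = false

module _ {G : Digraph 5} (U : UnderlyingIsPath G) where

  private
    arcs : ∀ x y → toℕ y ≡ suc (toℕ x) → ∃[ o ] (G x y ≡ hasForwardArc o × G y x ≡ hasBackwardArc o)
    arcs x y y≡1+x = orientationOfArcs (proj₂ (U x y) (inj₁ y≡1+x))

    nonEdge : ∀ x y {¬xy : False (PathAdj? x y)} → G x y ≡ false
    nonEdge x y {¬xy} = ¬-not (toWitnessFalse ¬xy ∘ proj₁ (U x y) ∘ inj₁)

  pathOrientation : ∃[ o₁ ] ∃[ o₂ ] ∃[ o₃ ] ∃[ o₄ ] G ≗₂ orientedPath o₁ o₂ o₃ o₄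
  pathOrientation with arcs 0F 1F refl | arcs 1F 2F refl | arcs 2F 3F refl | arcs 3F 4F refl
  ... | o₁ , f₁ , b₁ | o₂ , f₂ , b₂ | o₃ , f₃ , b₃ | o₄ , f₄ , b₄ = o₁ , o₂ , o₃ , o₄ , λ where
    0F 1F → f₁
    1F 0F → b₁
    1F 2F → f₂
    2F 1F → b₂
    2F 3F → f₃
    3F 2F → b₃
    3F 4F → f₄
    4F 3F → b₄
    0F 0F → nonEdge 0F 0F
    0F 2F → nonEdge 0F 2F
    0F 3F → nonEdge 0F 3F
    0F 4F → nonEdge 0F 4F
    1F 1F → nonEdge 1F 1F
    1F 3F → nonEdge 1F 3F
    1F 4F → nonEdge 1F 4F
    2F 0F → nonEdge 2F 0F
    2F 2F → nonEdge 2F 2F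
    2F 4F → nonEdge 2F 4F
    3F 0F → nonEdge 3F 0F
    3F 1F → nonEdge 3F 1F
    3F 3F → nonEdge 3F 3F
    4F 0F → nonEdge 4F 0F
    4F 1F → nonEdge 4F 1F
    4F 2F → nonEdge 4F 2F
    4F 4F → nonEdge 4F 4F

-- Two relabellings suffice: they are the automorphisms of the undirected path.
symmetry : Fin 2 → Permutation′ 5
symmetry 0F = Permutation.id
symmetry 1F = Permutation.reverse

orientedPath-classification :
  ∀ o₁ o₂ o₃ o₄ → let G = orientedPath o₁ o₂ o₃ o₄ in N1 G → N2 G → N3 G →
  ∃[ i ] ∃[ s ] IsomorphicVia G (sixGraphs i) (symmetry s)
orientedPath-classification = toWitness {a? =
  all-orientations? λ o₁ → all-orientations? λ o₂ → all-orientations? λ o₃ → all-orientations? λ o₄ →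
    let G = orientedPath o₁ o₂ o₃ o₄ in N1? G →-dec N2? G →-dec N3? G →-dec
    any? λ i → any? λ s → IsomorphicVia? G (sixGraphs i) (symmetry s)} _

sixGraphs-valid : ∀ i → let G = sixGraphs i in
                  Loopless G × N1 G × N2 G × N3 G × UnderlyingIsPath G
sixGraphs-valid = toWitness {a? = all? λ i → let G = sixGraphs i in
  Loopless? G ×-dec N1? G ×-dec N2? G ×-dec N3? G ×-dec UnderlyingIsPath? G} _

sixGraphs-separated : ∀ i j → let G = sixGraphs i ; H = sixGraphs j in
                      edgeCount G ≡ edgeCount H → sourceCount G ≡ sourceCount H → i ≡ j
sixGraphs-separated = toWitness {a? = all? λ i → all? λ j → let G = sixGraphs i ; H = sixGraphs j in
  edgeCount G ≟ℕ edgeCount H →-dec sourceCount G ≟ℕ sourceCount H →-dec i ≟ᶠ j} _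

theorem3p2 : (∀ i → Is2qBMG (sixGraphs i) × UnderlyingIsPath (sixGraphs i))
    × (∀ i j → Isomorphic (sixGraphs i) (sixGraphs j) → i ≡ j)
    × (∀ (G : Digraph 5) → Is2qBMG G → UnderlyingIsPath G →
    ∃[ i ] Isomorphic G (sixGraphs i))
theorem3p2 = valid , nonisomorphic , complete
  where
  valid : ∀ i → Is2qBMG (sixGraphs i) × UnderlyingIsPath (sixGraphs i)
  valid i = let loopless , n1 , n2 , n3 , path = sixGraphs-valid i in
            (loopless , path-bipartite path , n1 , n2 , n3) , path

  nonisomorphic : ∀ i j → Isomorphic (sixGraphs i) (sixGraphs j) → i ≡ j
  nonisomorphic i j iso = sixGraphs-separated i j (edgeCount-iso {G = sixGraphs i} {sixGraphs j} iso)
                                                  (sourceCount-iso {G = sixGraphs i} {sixGraphs j} iso)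

  complete : ∀ G → Is2qBMG G → UnderlyingIsPath G → ∃[ i ] Isomorphic G (sixGraphs i)
  complete G (_ , _ , n1 , n2 , n3) path =
    let o₁ , o₂ , o₃ , o₄ , G≗P = pathOrientation path
        i , s , P≅Gᵢ = orientedPath-classification o₁ o₂ o₃ o₄
                         (N1-resp-≗₂ G≗P n1) (N2-resp-≗₂ G≗P n2) (N3-resp-≗₂ G≗P n3)
    in i , symmetry s , λ x y → trans (G≗P x y) (P≅Gᵢ x y)
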